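{- For $n \ge 3$, the number $\tau(P_2 \square C_n)$ of minimum dominating sets of $P_2 \square C_n$ satisfies $\tau(P_2 \square C_n) = 4$ if $n \equiv 0 \pmod 4$; $2n$ if $n \equiv 1,3 \pmod 4$ and $n \ne 3$; $n(n+2)$ if $n \equiv 2 \pmod 4$ and $n \ne 6$; $9$ if $n=3$; $51$ if $n=6$.
   Context: $P_2 \square C_n$ is the Cartesian product of the path on 2 vertices with the cycle on $n$ vertices. A minimum dominating set of a graph $G$ is a set $D\subseteq V(G)$ of minimum cardinality such that every vertex not in $D$ is adjacent to a vertex of $D$; $\tau(G)$ denotes the total number of minimum dominating sets of $G$. -}

module Defs where

open import Data.Bool using (Bool; true; false; _∧_; _∨_; not)
open import Data.Nat using (ℕ; zero; suc; _+_; _*_; _∸_; _≤ᵇ_; _≡ᵇ_)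
open import Data.Fin using (Fin; zero; suc; toℕ)
open import Data.Fin.Subset using (Subset; ∣_∣)
open import Data.Product using (_×_; _,_; proj₁; proj₂)
open import Data.List using (List; []; _∷_; map; filter; length; allFin; concatMap; foldr)
open import Data.Bool.ListAction using (any; all)
open import Data.Vec using (Vec; []; _∷_; lookup)
open import Data.Nat.Properties using (_≤?_)

record FinGraph : Set₁ where
  field
    Vertex   : Set
    vertices : List Vertex          -- complete, duplicate-free list of vertices
    adj      : Vertex → Vertex → Bool
    VSet     : Set
    subsets  : List VSet            -- every subset listed exactly once
    mem      : VSet → Vertex → Bool
    size     : VSet → ℕ

open FinGraph public

isDominating : (G : FinGraph) → VSet G → Bool
isDominating G D =
  all (λ v → mem G D v ∨ any (λ u → mem G D u ∧ adj G u v) (vertices G)) (vertices G)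

-- domination number γ(G): minimum size of a dominating set
-- (fold over all dominating subsets; the vertex set itself is always
-- dominating, so the initial value "number of vertices" is an upper bound).
minℕ : ℕ → ℕ → ℕ
minℕ a b with a ≤ᵇ b
... | true  = a
... | false = b

dominatingSets : (G : FinGraph) → List (VSet G)
dominatingSets G = filter (λ D → Data.Bool._≟_ (isDominating G D) true) (subsets G)

γ : FinGraph → ℕ
γ G = foldr (λ D m → minℕ (size G D) m) (length (vertices G)) (dominatingSets G)

τ : FinGraph → ℕ
τ G = length (filter (λ D → size G D Data.Nat.≟ γ G) (dominatingSets G))

allSubsets : (n : ℕ) → List (Subset n)
allSubsets zero    = [] ∷ []
allSubsets (suc n) = concatMap (λ s → (true ∷ s) ∷ (false ∷ s) ∷ []) (allSubsets n)

-- P₂ □ Cₙ : vertex (i , j) with i ∈ Fin 2 (path coordinate) and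
-- j ∈ Fin n (cycle coordinate).  (i,j) ~ (i',j') iff
--   i = i' and j, j' adjacent in Cₙ, or
--   j = j' and i ≠ i'  (adjacent in P₂).

finEq : ∀ {k} → Fin k → Fin k → Bool
finEq a b = toℕ a ≡ᵇ toℕ b

cycAdj : (n : ℕ) → Fin n → Fin n → Bool
cycAdj n a b = (succMod a b ∨ succMod b a) ∧ not (finEq a b)
  where
    succMod : Fin n → Fin n → Bool
    succMod x y = (suc (toℕ x) ≡ᵇ toℕ y)
                  ∨ ((suc (toℕ x) ≡ᵇ n) ∧ (toℕ y ≡ᵇ 0))

P₂□C : ℕ → FinGraph
P₂□C n = record
  { Vertex   = Fin 2 × Fin n
  ; vertices = concatMap (λ i → map (λ j → (i , j)) (allFin n)) (allFin 2)
  ; adj      = λ { (i , j) (i' , j') →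
                   (finEq i i' ∧ cycAdj n j j') ∨ (finEq j j' ∧ not (finEq i i')) }
  ; VSet     = Subset n × Subset n            -- (layer 0 part , layer 1 part)
  ; subsets  = concatMap (λ s → map (λ t → (s , t)) (allSubsets n)) (allSubsets n)
  ; mem      = λ { (s , t) (zero , j) → lookup s j
                 ; (s , t) (suc _ , j) → lookup t j }
  ; size     = λ { (s , t) → ∣ s ∣ + ∣ t ∣ }
  }

module Submission where

-- A vertex set D of P₂ □ Cₙ is a cyclic word u₀ … uₙ₋₁ of columns (two
-- Booleans each), and D dominates iff every column is "covered" by itself and
-- its two cyclic neighbours.  We count in the min-count semiring, whose
-- elements `val w c` say "the least weight is w, attained c times": the sum,
-- over all dominating sets, of `val |D| 1` is `val γ τ`.  Conditioning on the
-- first two and the last two columns turns this sum into the trace of a power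
-- of a 16 × 16 transfer matrix, the table R m (n = m + 2).
--
-- Finally
-- the tables are evaluated: for n ≤ 12 by direct (memoised) computation, and
-- for n ≥ 13 by a periodicity certificate: the entries of R (11 + 4k) are
-- `val (2k + c) (a + bk + d·T(k))` (T(k) the triangular number), and four
-- steps of the transfer matrix map this family for k to the family for k + 1.
-- Reading off the four residue classes mod 4 gives the theorem.

open import Defs
open import Data.Nat using (ℕ; _≤_; _*_; _+_; _%_)
open import Relation.Binary.PropositionalEquality using (_≡_; _≢_)
open import Data.Product using (_×_)

module MinCountSemiring where

  open import Data.Bool using (Bool; true; false; _∧_; if_then_else_; T)
  open import Data.Bool.Properties using (∧-conicalˡ; ∧-conicalʳ)
  open import Data.Nat using (ℕ; _+_; _*_; _<_; _≤_; _<ᵇ_; _≡ᵇ_)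
  open import Data.Nat.Properties
  open import Relation.Binary.PropositionalEquality
  open import Relation.Binary.Definitions using (tri<; tri≈; tri>)
  open import Data.Empty using (⊥-elim)

  -- `val w c`: among some weighted objects the least weight is w and exactly
  -- c objects attain it; `none`: there are no objects.
  data MinCount : Set where
    none : MinCount
    val  : (w c : ℕ) → MinCount

  infixl 6 _⊕_
  infixl 7 _⊗_

  -- disjoint union of two families: keep the smaller minimum, add counts on a tie
  _⊕_ : MinCount → MinCount → MinCount
  none    ⊕ y       = y
  val a c ⊕ none    = val a c
  val a c ⊕ val b d =
    if a <ᵇ b then val a c else (if b <ᵇ a then val b d else val a (c + d))

  -- pairs from two families: weights add, counts multiply
  _⊗_ : MinCount → MinCount → MinCount
  none    ⊗ _       = none
  val _ _ ⊗ none    = none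
  val a c ⊗ val b d = val (a + b) (c * d)

  private
    <ᵇ-true : ∀ {a b} → a < b → (a <ᵇ b) ≡ true
    <ᵇ-true {a} {b} a<b with a <ᵇ b | <⇒<ᵇ a<b
    ... | true | _ = refl

    <ᵇ-false : ∀ {a b} → b ≤ a → (a <ᵇ b) ≡ false
    <ᵇ-false {a} {b} b≤a with a <ᵇ b in eq
    ... | false = refl
    ... | true  = ⊥-elim (<⇒≱ (<ᵇ⇒< a b (subst T (sym eq) _)) b≤a)

  ⊕-< : ∀ {a b} c d → a < b → val a c ⊕ val b d ≡ val a c
  ⊕-< c d a<b rewrite <ᵇ-true a<b = refl

  ⊕-> : ∀ {a b} c d → b < a → val a c ⊕ val b d ≡ val b d
  ⊕-> c d b<a rewrite <ᵇ-false (<⇒≤ b<a) | <ᵇ-true b<a = refl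

  ⊕-≡ : ∀ {a} c d → val a c ⊕ val a d ≡ val a (c + d)
  ⊕-≡ {a} c d rewrite <ᵇ-false {a} {a} ≤-refl = refl

  ⊕-identityʳ : ∀ x → x ⊕ none ≡ x
  ⊕-identityʳ none      = refl
  ⊕-identityʳ (val _ _) = refl

  ⊕-comm : ∀ x y → x ⊕ y ≡ y ⊕ x
  ⊕-comm none      y         = sym (⊕-identityʳ y)
  ⊕-comm (val a c) none      = refl
  ⊕-comm (val a c) (val b d) with <-cmp a b
  ... | tri< a<b _ _    = trans (⊕-< c d a<b) (sym (⊕-> d c a<b))
  ... | tri≈ _ refl _   = trans (⊕-≡ c d) (trans (cong (val a) (+-comm c d)) (sym (⊕-≡ d c)))
  ... | tri> _ _ b<a    = trans (⊕-> c d b<a) (sym (⊕-< d c b<a))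

  ⊕-assoc : ∀ x y z → (x ⊕ y) ⊕ z ≡ x ⊕ (y ⊕ z)
  ⊕-assoc none      y         z    = refl
  ⊕-assoc (val a c) none      z    = refl
  ⊕-assoc (val a c) (val b d) none =
    trans (⊕-identityʳ (val a c ⊕ val b d)) (cong (val a c ⊕_) (sym (⊕-identityʳ (val b d))))
  ⊕-assoc (val a c) (val b d) (val e f) with <-cmp a b
  ⊕-assoc (val a c) (val b d) (val e f) | tri< ab _ _ with <-cmp b e
  ... | tri< be _ _ rewrite ⊕-< c d ab | ⊕-< c f (<-trans ab be) | ⊕-< d f be | ⊕-< c d ab = refl
  ... | tri≈ _ refl _ rewrite ⊕-< c d ab | ⊕-< c f ab | ⊕-≡ {b} d f | ⊕-< c (d + f) ab = refl
  ... | tri> _ _ eb with <-cmp a e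
  ...   | tri< ae _ _ rewrite ⊕-< c d ab | ⊕-< c f ae | ⊕-> d f eb | ⊕-< c f ae = refl
  ...   | tri≈ _ refl _ rewrite ⊕-< c d ab | ⊕-≡ {a} c f | ⊕-> d f eb | ⊕-≡ {a} c f = refl
  ...   | tri> _ _ ea rewrite ⊕-< c d ab | ⊕-> c f ea | ⊕-> d f eb | ⊕-> c f ea = refl
  ⊕-assoc (val a c) (val b d) (val e f) | tri≈ _ refl _ with <-cmp a e
  ... | tri< ae _ _ rewrite ⊕-≡ {a} c d | ⊕-< (c + d) f ae | ⊕-< d f ae | ⊕-≡ {a} c d = refl
  ... | tri≈ _ refl _ rewrite ⊕-≡ {a} c d | ⊕-≡ {a} (c + d) f | ⊕-≡ {a} d f
                            | ⊕-≡ {a} c (d + f) | +-assoc c d f = refl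
  ... | tri> _ _ ea rewrite ⊕-≡ {a} c d | ⊕-> (c + d) f ea | ⊕-> d f ea | ⊕-> c f ea = refl
  ⊕-assoc (val a c) (val b d) (val e f) | tri> _ _ ba with <-cmp b e
  ... | tri< be _ _ rewrite ⊕-> c d ba | ⊕-< d f be | ⊕-> c d ba = refl
  ... | tri≈ _ refl _ rewrite ⊕-> c d ba | ⊕-≡ {b} d f | ⊕-> c (d + f) ba = refl
  ... | tri> _ _ eb rewrite ⊕-> c d ba | ⊕-> d f eb | ⊕-> c f (<-trans eb ba) = refl

  ⊕-interchange : ∀ a b c d → (a ⊕ b) ⊕ (c ⊕ d) ≡ (a ⊕ c) ⊕ (b ⊕ d)
  ⊕-interchange a b c d = begin
    (a ⊕ b) ⊕ (c ⊕ d)   ≡⟨ ⊕-assoc a b (c ⊕ d) ⟩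
    a ⊕ (b ⊕ (c ⊕ d))   ≡⟨ cong (a ⊕_) (sym (⊕-assoc b c d)) ⟩
    a ⊕ ((b ⊕ c) ⊕ d)   ≡⟨ cong (λ x → a ⊕ (x ⊕ d)) (⊕-comm b c) ⟩
    a ⊕ ((c ⊕ b) ⊕ d)   ≡⟨ cong (a ⊕_) (⊕-assoc c b d) ⟩
    a ⊕ (c ⊕ (b ⊕ d))   ≡⟨ sym (⊕-assoc a c (b ⊕ d)) ⟩
    (a ⊕ c) ⊕ (b ⊕ d)   ∎
    where open ≡-Reasoning

  ⊗-distribˡ-⊕ : ∀ s x y → s ⊗ (x ⊕ y) ≡ s ⊗ x ⊕ s ⊗ y
  ⊗-distribˡ-⊕ none      x         y         = refl
  ⊗-distribˡ-⊕ (val w n) none      y         = refl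
  ⊗-distribˡ-⊕ (val w n) (val a c) none      = refl
  ⊗-distribˡ-⊕ (val w n) (val a c) (val b d) with <-cmp a b
  ... | tri< a<b _ _ rewrite ⊕-< c d a<b | ⊕-< (n * c) (n * d) (+-monoʳ-< w a<b) = refl
  ... | tri≈ _ refl _ rewrite ⊕-≡ {a} c d | ⊕-≡ {w + a} (n * c) (n * d) | *-distribˡ-+ n c d = refl
  ... | tri> _ _ b<a rewrite ⊕-> c d b<a | ⊕-> (n * c) (n * d) (+-monoʳ-< w b<a) = refl

  val⊕-nonempty : ∀ a c x → val a c ⊕ x ≢ none
  val⊕-nonempty a c none      ()
  val⊕-nonempty a c (val b d) eq with <-cmp a b
  ... | tri< a<b _ _  with () ← trans (sym (⊕-< c d a<b)) eq
  ... | tri≈ _ refl _ with () ← trans (sym (⊕-≡ {a} c d)) eq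
  ... | tri> _ _ b<a  with () ← trans (sym (⊕-> c d b<a)) eq

  ≡ᵇ-sound : ∀ {a b} → (a ≡ᵇ b) ≡ true → a ≡ b
  ≡ᵇ-sound {a} {b} e = ≡ᵇ⇒≡ a b (subst T (sym e) _)

  sameMinCount : MinCount → MinCount → Bool
  sameMinCount none      none      = true
  sameMinCount (val a c) (val b d) = (a ≡ᵇ b) ∧ (c ≡ᵇ d)
  sameMinCount _         _         = false

  sameMinCount-sound : ∀ x y → sameMinCount x y ≡ true → x ≡ y
  sameMinCount-sound none      none      _ = refl
  sameMinCount-sound (val a c) (val b d) e =
    cong₂ val (≡ᵇ-sound (∧-conicalˡ _ _ e)) (≡ᵇ-sound (∧-conicalʳ (a ≡ᵇ b) _ e))

  keepIf : Bool → MinCount → MinCount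
  keepIf true  x = x
  keepIf false _ = none

module TransferMatrix where

  open import Data.Bool using (Bool; true; false; _∧_; _∨_; if_then_else_)
  open import Data.Nat using (ℕ; zero; suc; _+_)
  open import Data.Fin using (Fin; zero; suc)
  open import Data.Product using (_×_; _,_; proj₁; proj₂)
  open import Relation.Binary.PropositionalEquality
  open MinCountSemiring

  -- A column of the ladder seen through a vertex set D: is its top vertex in
  -- D, is its bottom vertex in D.
  Col : Set
  Col = Bool × Bool

  weight : Col → ℕ
  weight (t , b) = (if t then 1 else 0) + (if b then 1 else 0)

  Row : Set
  Row = Fin 2

  bit : Row → Col → Bool
  bit zero    = proj₁
  bit (suc _) = proj₂

  other : Row → Row
  other zero    = suc zero
  other (suc _) = zero

  -- `coversRow i a b c`: when column b sits between columns a and c, its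
  -- row-i vertex is dominated (by b itself or by the row-i vertex of a or c)
  coversRow : Row → Col → Col → Col → Bool
  coversRow i a b c = bit i b ∨ bit (other i) b ∨ bit i a ∨ bit i c

  covered : Col → Col → Col → Bool
  covered a b c = coversRow zero a b c ∧ coversRow (suc zero) a b c

  keepIf-∧ : ∀ p q x y → keepIf (p ∧ q) (val (x + y) 1) ≡ keepIf p (val x 1) ⊗ keepIf q (val y 1)
  keepIf-∧ false q     x y = refl
  keepIf-∧ true  false x y = refl
  keepIf-∧ true  true  x y = refl

  -- A table indexed by the first two and the last two columns of a word.
  Tab : Set → Set
  Tab A = Col → Col → Col → Col → A

  -- The transfer step and the cyclic trace, over any type with a sum and an
  -- action of MinCount (used for MinCount itself and for periodic families).
  module Transfer {A : Set} (_⊞_ : A → A → A) (_▷_ : MinCount → A → A) where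

    sumCol : (Col → A) → A
    sumCol g = (g (true , true) ⊞ g (true , false)) ⊞ (g (false , true) ⊞ g (false , false))

    -- prepend a column a to words starting with b c, requiring b to be covered
    step : Tab A → Tab A
    step X a b e₁ e₂ = sumCol λ c → keepIf (covered a b c) (val (weight c) 1) ▷ X b c e₁ e₂

    -- close a word into a cycle: its last two columns are its first two
    trace : Tab A → A
    trace X = sumCol λ a → sumCol λ b → val (weight a + weight b) 1 ▷ X a b a b

    infix 4 _≈_
    _≈_ : Tab A → Tab A → Set
    X ≈ Y = ∀ a b e₁ e₂ → X a b e₁ e₂ ≡ Y a b e₁ e₂

    sumCol-cong : ∀ {g h} → (∀ c → g c ≡ h c) → sumCol g ≡ sumCol h
    sumCol-cong {g} {h} eq
      rewrite eq (true , true) | eq (true , false) | eq (false , true) | eq (false , false) = refl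

    step-cong : ∀ {X Y} → X ≈ Y → step X ≈ step Y
    step-cong eq a b e₁ e₂ =
      sumCol-cong λ c → cong (keepIf (covered a b c) (val (weight c) 1) ▷_) (eq b c e₁ e₂)

    trace-cong : ∀ {X Y} → X ≈ Y → trace X ≡ trace Y
    trace-cong eq =
      sumCol-cong λ a → sumCol-cong λ b → cong (val (weight a + weight b) 1 ▷_) (eq a b a b)

  module TransferHom {A B : Set} {_⊞_ : A → A → A} {_▷_ : MinCount → A → A}
                     {_⊞′_ : B → B → B} {_▷′_ : MinCount → B → B}
                     (f : A → B)
                     (f-⊞ : ∀ x y → f (x ⊞ y) ≡ f x ⊞′ f y)
                     (f-▷ : ∀ s x → f (s ▷ x) ≡ s ▷′ f x) where

    private
      module S = Transfer _⊞_ _▷_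
      module T = Transfer _⊞′_ _▷′_

    mapTab : Tab A → Tab B
    mapTab X a b e₁ e₂ = f (X a b e₁ e₂)

    sumCol-hom : ∀ g → f (S.sumCol g) ≡ T.sumCol (λ c → f (g c))
    sumCol-hom g rewrite f-⊞ (g (true , true) ⊞ g (true , false)) (g (false , true) ⊞ g (false , false))
                       | f-⊞ (g (true , true)) (g (true , false))
                       | f-⊞ (g (false , true)) (g (false , false)) = refl

    step-hom : ∀ X → mapTab (S.step X) T.≈ T.step (mapTab X)
    step-hom X a b e₁ e₂ =
      trans (sumCol-hom (λ c → keepIf (covered a b c) (val (weight c) 1) ▷ X b c e₁ e₂))
            (T.sumCol-cong λ c → f-▷ (keepIf (covered a b c) (val (weight c) 1)) (X b c e₁ e₂))

    trace-hom : ∀ X → f (S.trace X) ≡ T.trace (mapTab X)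
    trace-hom X = trans (sumCol-hom (λ a → S.sumCol λ b → val (weight a + weight b) 1 ▷ X a b a b))
                   (T.sumCol-cong λ a →
                    trans (sumCol-hom (λ b → val (weight a + weight b) 1 ▷ X a b a b))
                      (T.sumCol-cong λ b → f-▷ (val (weight a + weight b) 1) (X a b a b)))

  open Transfer _⊕_ _⊗_ public

  -- the closing condition of a word a b … e₁ e₂ with nothing in between
  closing : Tab MinCount
  closing a b e₁ e₂ = keepIf (covered a b e₁ ∧ covered b e₁ e₂) (val 0 1)

  -- R m: words a b w e₁ e₂ with |w| = m all of whose inner columns are covered,
  -- summed by the weight of w (made precise in `chain-sum` below)
  R : ℕ → Tab MinCount
  R zero    = closing
  R (suc m) = step (R m)

module Sums where

  open import Data.Bool using (Bool; true; false; _∧_)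
  import Data.Bool as Bool
  open import Data.Nat using (ℕ; zero; suc; _+_)
  open import Data.Nat.Properties using (+-assoc)
  open import Data.Product using (proj₁; proj₂)
  open import Data.List using (List; []; _∷_; _++_; foldr; map; concatMap; filter)
  open import Data.Vec using (Vec; []; _∷_)
  import Data.Vec as Vec
  open import Relation.Binary.PropositionalEquality
  open MinCountSemiring
  open TransferMatrix
  open Defs using (allSubsets)

  sumList : {X : Set} → (X → MinCount) → List X → MinCount
  sumList F = foldr (λ x acc → F x ⊕ acc) none

  sumWords : (m : ℕ) → (Vec Col m → MinCount) → MinCount
  sumWords zero    F = F []
  sumWords (suc m) F = sumCol λ c → sumWords m λ w → F (c ∷ w)

  sumSubsets : (n : ℕ) → (Vec Bool n → MinCount) → MinCount
  sumSubsets zero    f = f []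
  sumSubsets (suc n) f = sumSubsets n (λ s → f (true ∷ s)) ⊕ sumSubsets n (λ s → f (false ∷ s))

  sumWords-cong : ∀ m {F G} → (∀ w → F w ≡ G w) → sumWords m F ≡ sumWords m G
  sumWords-cong zero    eq = eq []
  sumWords-cong (suc m) eq = sumCol-cong λ c → sumWords-cong m λ w → eq (c ∷ w)

  sumCol-⊗ : ∀ s g → sumCol (λ c → s ⊗ g c) ≡ s ⊗ sumCol g
  sumCol-⊗ s g = sym (trans (⊗-distribˡ-⊕ s _ _) (cong₂ _⊕_ (⊗-distribˡ-⊕ s _ _) (⊗-distribˡ-⊕ s _ _)))

  sumWords-⊗ : ∀ m s g → sumWords m (λ w → s ⊗ g w) ≡ s ⊗ sumWords m g
  sumWords-⊗ zero    s g = refl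
  sumWords-⊗ (suc m) s g = trans (sumCol-cong λ c → sumWords-⊗ m s (λ w → g (c ∷ w)))
                                 (sumCol-⊗ s (λ c → sumWords m (λ w → g (c ∷ w))))

  wordWeight : ∀ {m} → Vec Col m → ℕ
  wordWeight []      = 0
  wordWeight (c ∷ w) = weight c + wordWeight w

  chainCovered : ∀ {m} → Col → Col → Vec Col m → Col → Col → Bool
  chainCovered a b []      e₁ e₂ = covered a b e₁ ∧ covered b e₁ e₂
  chainCovered a b (c ∷ w) e₁ e₂ = covered a b c ∧ chainCovered b c w e₁ e₂

  chain-sum : ∀ m a b e₁ e₂ →
    sumWords m (λ w → keepIf (chainCovered a b w e₁ e₂) (val (wordWeight w) 1)) ≡ R m a b e₁ e₂
  chain-sum zero    a b e₁ e₂ = refl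
  chain-sum (suc m) a b e₁ e₂ = sumCol-cong λ c → begin
      sumWords m (λ w → keepIf (covered a b c ∧ chainCovered b c w e₁ e₂) (val (weight c + wordWeight w) 1))
    ≡⟨ sumWords-cong m (λ w → keepIf-∧ (covered a b c) (chainCovered b c w e₁ e₂) (weight c) (wordWeight w)) ⟩
      sumWords m (λ w → first c ⊗ keepIf (chainCovered b c w e₁ e₂) (val (wordWeight w) 1))
    ≡⟨ sumWords-⊗ m (first c) (λ w → keepIf (chainCovered b c w e₁ e₂) (val (wordWeight w) 1)) ⟩
      first c ⊗ sumWords m (λ w → keepIf (chainCovered b c w e₁ e₂) (val (wordWeight w) 1))
    ≡⟨ cong (first c ⊗_) (chain-sum m b c e₁ e₂) ⟩
      first c ⊗ R m b c e₁ e₂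
    ∎
    where
    open ≡-Reasoning
    first : Col → MinCount
    first c = keepIf (covered a b c) (val (weight c) 1)

  cyclicCovered : ∀ {n} → Vec Col n → Bool
  cyclicCovered (u₀ ∷ u₁ ∷ w) = chainCovered u₀ u₁ w u₀ u₁
  cyclicCovered _             = false

  private
    keepIf-split : ∀ q x y z → keepIf q (val (x + (y + z)) 1) ≡ val (x + y) 1 ⊗ keepIf q (val z 1)
    keepIf-split false x y z = refl
    keepIf-split true  x y z = cong₂ val (sym (+-assoc x y z)) refl

  cycle-sum : ∀ m →
    sumWords (suc (suc m)) (λ u → keepIf (cyclicCovered u) (val (wordWeight u) 1)) ≡ trace (R m)
  cycle-sum m = sumCol-cong λ a → sumCol-cong λ b →
    trans (sumWords-cong m (λ w → keepIf-split (chainCovered a b w a b) (weight a) (weight b) (wordWeight w)))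
     (trans (sumWords-⊗ m (val (weight a + weight b) 1) (λ w → keepIf (chainCovered a b w a b) (val (wordWeight w) 1)))
       (cong (val (weight a + weight b) 1 ⊗_) (chain-sum m a b a b)))

  sumSubsets-⊕ : ∀ n f g → sumSubsets n (λ s → f s ⊕ g s) ≡ sumSubsets n f ⊕ sumSubsets n g
  sumSubsets-⊕ zero    f g = refl
  sumSubsets-⊕ (suc n) f g =
    trans (cong₂ _⊕_ (sumSubsets-⊕ n (λ s → f (true ∷ s)) (λ s → g (true ∷ s)))
                     (sumSubsets-⊕ n (λ s → f (false ∷ s)) (λ s → g (false ∷ s))))
          (⊕-interchange (sumSubsets n (λ s → f (true ∷ s))) (sumSubsets n (λ s → g (true ∷ s)))
                         (sumSubsets n (λ s → f (false ∷ s))) (sumSubsets n (λ s → g (false ∷ s))))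

  sumSubsets-pairs : ∀ n (f : Vec Bool n → Vec Bool n → MinCount) →
    sumSubsets n (λ s → sumSubsets n (λ t → f s t)) ≡ sumWords n (λ u → f (Vec.map proj₁ u) (Vec.map proj₂ u))
  sumSubsets-pairs zero    f = refl
  sumSubsets-pairs (suc n) f =
    trans (cong₂ _⊕_ (sumSubsets-⊕ n (λ s → sumSubsets n (λ t → f (true ∷ s) (true ∷ t)))
                                     (λ s → sumSubsets n (λ t → f (true ∷ s) (false ∷ t))))
                     (sumSubsets-⊕ n (λ s → sumSubsets n (λ t → f (false ∷ s) (true ∷ t)))
                                     (λ s → sumSubsets n (λ t → f (false ∷ s) (false ∷ t)))))
      (cong₂ _⊕_ (cong₂ _⊕_ (sumSubsets-pairs n λ s t → f (true ∷ s) (true ∷ t))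
                            (sumSubsets-pairs n λ s t → f (true ∷ s) (false ∷ t)))
                 (cong₂ _⊕_ (sumSubsets-pairs n λ s t → f (false ∷ s) (true ∷ t))
                            (sumSubsets-pairs n λ s t → f (false ∷ s) (false ∷ t))))

  sumList-cong : {X : Set} {F G : X → MinCount} → (∀ x → F x ≡ G x) → ∀ xs → sumList F xs ≡ sumList G xs
  sumList-cong eq []       = refl
  sumList-cong eq (x ∷ xs) = cong₂ _⊕_ (eq x) (sumList-cong eq xs)

  sumList-++ : {X : Set} (F : X → MinCount) → ∀ xs ys → sumList F (xs ++ ys) ≡ sumList F xs ⊕ sumList F ys
  sumList-++ F []       ys = refl
  sumList-++ F (x ∷ xs) ys = trans (cong (F x ⊕_) (sumList-++ F xs ys)) (sym (⊕-assoc (F x) _ _))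

  sumList-concatMap : {X Y : Set} (F : Y → MinCount) (g : X → List Y) →
    ∀ xs → sumList F (concatMap g xs) ≡ sumList (λ x → sumList F (g x)) xs
  sumList-concatMap F g []       = refl
  sumList-concatMap F g (x ∷ xs) =
    trans (sumList-++ F (g x) (concatMap g xs)) (cong (sumList F (g x) ⊕_) (sumList-concatMap F g xs))

  sumList-map : {X Y : Set} (F : Y → MinCount) (g : X → Y) → ∀ xs → sumList F (map g xs) ≡ sumList (λ x → F (g x)) xs
  sumList-map F g []       = refl
  sumList-map F g (x ∷ xs) = cong (F (g x) ⊕_) (sumList-map F g xs)

  sumList-⊕ : {X : Set} (F G : X → MinCount) → ∀ xs → sumList (λ x → F x ⊕ G x) xs ≡ sumList F xs ⊕ sumList G xs
  sumList-⊕ F G []       = refl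
  sumList-⊕ F G (x ∷ xs) = trans (cong ((F x ⊕ G x) ⊕_) (sumList-⊕ F G xs)) (⊕-interchange (F x) (G x) _ _)

  sumList-allSubsets : ∀ n F → sumList F (allSubsets n) ≡ sumSubsets n F
  sumList-allSubsets zero    F = ⊕-identityʳ (F [])
  sumList-allSubsets (suc n) F = begin
      sumList F (concatMap (λ s → (true ∷ s) ∷ (false ∷ s) ∷ []) (allSubsets n))
    ≡⟨ sumList-concatMap F (λ s → (true ∷ s) ∷ (false ∷ s) ∷ []) (allSubsets n) ⟩
      sumList (λ s → F (true ∷ s) ⊕ (F (false ∷ s) ⊕ none)) (allSubsets n)
    ≡⟨ sumList-cong (λ s → cong (F (true ∷ s) ⊕_) (⊕-identityʳ (F (false ∷ s)))) (allSubsets n) ⟩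
      sumList (λ s → F (true ∷ s) ⊕ F (false ∷ s)) (allSubsets n)
    ≡⟨ sumList-⊕ (λ s → F (true ∷ s)) (λ s → F (false ∷ s)) (allSubsets n) ⟩
      sumList (λ s → F (true ∷ s)) (allSubsets n) ⊕ sumList (λ s → F (false ∷ s)) (allSubsets n)
    ≡⟨ cong₂ _⊕_ (sumList-allSubsets n (λ s → F (true ∷ s))) (sumList-allSubsets n (λ s → F (false ∷ s))) ⟩
      sumSubsets n (λ s → F (true ∷ s)) ⊕ sumSubsets n (λ s → F (false ∷ s))
    ∎
    where open ≡-Reasoning

  sumList-filter : {X : Set} (p : X → Bool) (g : X → MinCount) → ∀ xs →
    sumList (λ x → keepIf (p x) (g x)) xs ≡ sumList g (filter (λ x → p x Bool.≟ true) xs)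
  sumList-filter p g []       = refl
  sumList-filter p g (x ∷ xs) with p x
  ... | true  = cong (g x ⊕_) (sumList-filter p g xs)
  ... | false = sumList-filter p g xs

module MinimumAndCount where

  open import Data.Bool using (true; false; T)
  open import Data.Nat using (ℕ; suc; _<_; _≤ᵇ_; _⊓_; _≟_)
  open import Data.Nat.Properties
  open import Data.List using (List; []; _∷_; foldr; filter; length)
  open import Data.List.Properties using (filter-accept; filter-reject)
  open import Relation.Binary.PropositionalEquality
  open import Relation.Binary.Definitions using (tri<; tri≈; tri>)
  open import Data.Empty using (⊥-elim)
  open MinCountSemiring
  open Sums using (sumList)
  open Defs using (minℕ)

  minℕ-⊓ : ∀ a b → minℕ a b ≡ a ⊓ b
  minℕ-⊓ a b with a ≤ᵇ b in eq
  ... | true  = sym (m≤n⇒m⊓n≡m (≤ᵇ⇒≤ a b (subst T (sym eq) _)))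
  ... | false = sym (m≥n⇒m⊓n≡n (≰⇒≥ λ a≤b → subst T eq (≤⇒≤ᵇ a≤b)))

  module _ {X : Set} (w : X → ℕ) where

    foldMin : ℕ → List X → ℕ
    foldMin i = foldr (λ y m → minℕ (w y) m) i

    count : ℕ → List X → ℕ
    count x ys = length (filter (λ y → w y ≟ x) ys)

    record Summary (ys : List X) (g c : ℕ) : Set where
      field
        fold-min    : ∀ i → foldMin i ys ≡ g ⊓ i
        count-min   : count g ys ≡ c
        count-below : ∀ x → x < g → count x ys ≡ 0

    single : X → MinCount
    single y = val (w y) 1

    private
      count-∷-hit : ∀ {x y} ys → w y ≡ x → count x (y ∷ ys) ≡ suc (count x ys)
      count-∷-hit {x} ys hit = cong length (filter-accept (λ y → w y ≟ x) hit)

      count-∷-miss : ∀ {x y} ys → w y ≢ x → count x (y ∷ ys) ≡ count x ys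
      count-∷-miss {x} ys miss = cong length (filter-reject (λ y → w y ≟ x) miss)

      empty-list : ∀ ys → sumList single ys ≡ none → ys ≡ []
      empty-list []       _  = refl
      empty-list (y ∷ ys) eq = ⊥-elim (val⊕-nonempty (w y) 1 (sumList single ys) eq)

      fold-∷ : ∀ y ys {g′ g} → (∀ i → foldMin i ys ≡ g′ ⊓ i) → w y ⊓ g′ ≡ g →
               ∀ i → foldMin i (y ∷ ys) ≡ g ⊓ i
      fold-∷ y ys {g′} IH eq i = begin
        minℕ (w y) (foldMin i ys) ≡⟨ minℕ-⊓ (w y) (foldMin i ys) ⟩
        w y ⊓ foldMin i ys        ≡⟨ cong (w y ⊓_) (IH i) ⟩
        w y ⊓ (g′ ⊓ i)            ≡⟨ sym (⊓-assoc (w y) g′ i) ⟩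
        (w y ⊓ g′) ⊓ i            ≡⟨ cong (_⊓ i) eq ⟩
        _ ∎
        where open ≡-Reasoning

    summary : ∀ ys {g c} → sumList single ys ≡ val g c → Summary ys g c
    summary []       ()
    summary (y ∷ ys) eq with sumList single ys in rest
    summary (y ∷ ys) refl | none with refl ← empty-list ys rest = record
      { fold-min    = minℕ-⊓ (w y)
      ; count-min   = count-∷-hit [] refl
      ; count-below = λ x x<g → count-∷-miss [] (λ e → <-irrefl (sym e) x<g) }
    summary (y ∷ ys) eq   | val g′ c′ with summary ys rest | <-cmp (w y) g′
    ... | IH | tri< y<g′ _ _ with refl ← trans (sym (⊕-< 1 c′ y<g′)) eq = record
      { fold-min    = fold-∷ y ys (fold-min IH) (m≤n⇒m⊓n≡m (<⇒≤ y<g′))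
      ; count-min   = trans (count-∷-hit ys refl) (cong suc (count-below IH (w y) y<g′))
      ; count-below = λ x x<g → trans (count-∷-miss ys (λ e → <-irrefl (sym e) x<g))
                                      (count-below IH x (<-trans x<g y<g′)) }
      where open Summary
    ... | IH | tri≈ _ refl _ with refl ← trans (sym (⊕-≡ {w y} 1 c′)) eq = record
      { fold-min    = fold-∷ y ys (fold-min IH) (⊓-idem (w y))
      ; count-min   = trans (count-∷-hit ys refl) (cong suc (count-min IH))
      ; count-below = λ x x<g → trans (count-∷-miss ys (λ e → <-irrefl (sym e) x<g)) (count-below IH x x<g) }
      where open Summary
    ... | IH | tri> _ _ g′<y with refl ← trans (sym (⊕-> 1 c′ g′<y)) eq = record
      { fold-min    = fold-∷ y ys (fold-min IH) (m≥n⇒m⊓n≡n (<⇒≤ g′<y))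
      ; count-min   = trans (count-∷-miss ys (λ e → <-irrefl (sym e) g′<y)) (count-min IH)
      ; count-below = λ x x<g → trans (count-∷-miss ys (λ e → <-irrefl (sym e) (<-trans x<g g′<y)))
                                      (count-below IH x x<g) }
      where open Summary

module Domination where

  open import Data.Bool using (Bool; true; false; _∧_; _∨_; not; if_then_else_; T)
  open import Data.Bool.Properties using (T-∧; T-∨)
  open import Data.Bool.ListAction using (any)
  open import Data.Nat using (ℕ; zero; suc; _+_; _∸_; _<_; _≤_; z≤n; s≤s; _≡ᵇ_)
  open import Data.Nat.Properties
  open import Data.Fin using (Fin; zero; suc; toℕ; fromℕ<)
  open import Data.Fin.Properties using (toℕ<n; toℕ-fromℕ<; toℕ-injective)
  open import Data.Product using (_×_; _,_; proj₁; proj₂)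
  open import Data.Sum using (_⊎_; inj₁; inj₂)
  open import Data.List using (List; []; _∷_; _++_; map; allFin)
  open import Data.List.Membership.Propositional using (_∈_; lose)
  open import Data.List.Membership.Propositional.Properties using (∈-map⁺; ∈-++⁺ˡ; ∈-++⁺ʳ; ∈-allFin)
  import Data.List.Relation.Unary.All as All
  open import Data.List.Relation.Unary.All.Properties using (all⁺; all⁻)
  open import Data.List.Relation.Unary.Any using (satisfied)
  open import Data.List.Relation.Unary.Any.Properties using (any⁺; any⁻)
  open import Data.Vec using (Vec; []; _∷_; lookup; toList)
  import Data.Vec as Vec
  open import Data.Vec.Properties using (lookup-map)
  open import Function.Bundles using (Equivalence)
  open import Relation.Binary.PropositionalEquality
  open import Data.Empty using (⊥-elim)
  open import Data.Unit using (tt)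
  open TransferMatrix using (Col; Row; bit; other; coversRow; covered)
  open Sums using (chainCovered; cyclicCovered)
  open Defs

  private
    ∧-intro : ∀ {a b} → T a → T b → T (a ∧ b)
    ∧-intro p q = Equivalence.from T-∧ (p , q)

    ∧-elim : ∀ {a b} → T (a ∧ b) → T a × T b
    ∧-elim = Equivalence.to T-∧

    ∨-elim : ∀ {a b} → T (a ∨ b) → T a ⊎ T b
    ∨-elim = Equivalence.to T-∨

    ∨-inl : ∀ {a b} → T a → T (a ∨ b)
    ∨-inl p = Equivalence.from T-∨ (inj₁ p)

    ∨-inr : ∀ {a b} → T b → T (a ∨ b)
    ∨-inr p = Equivalence.from T-∨ (inj₂ p)

    ≢⇒not≡ᵇ : ∀ {x y} → x ≢ y → T (not (x ≡ᵇ y))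
    ≢⇒not≡ᵇ {x} {y} x≢y with x ≡ᵇ y in eq
    ... | true  = x≢y (≡ᵇ⇒≡ x y (subst T (sym eq) tt))
    ... | false = tt

    T-ext : ∀ {a b : Bool} → (T a → T b) → (T b → T a) → a ≡ b
    T-ext {false} {false} _ _ = refl
    T-ext {false} {true}  _ g = ⊥-elim (g tt)
    T-ext {true}  {false} f _ = ⊥-elim (f tt)
    T-ext {true}  {true}  _ _ = refl

  prev : ℕ → ℕ → ℕ
  prev n zero    = n ∸ 1
  prev n (suc y) = y

  next : ℕ → ℕ → ℕ
  next n y = if suc y ≡ᵇ n then 0 else suc y

  next-< : ∀ n y → suc y < n → next n y ≡ suc y
  next-< n y y+1<n with suc y ≡ᵇ n in eq
  ... | true  = ⊥-elim (<-irrefl (≡ᵇ⇒≡ (suc y) n (subst T (sym eq) tt)) y+1<n)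
  ... | false = refl

  next-≡ : ∀ n y → suc y ≡ n → next n y ≡ 0
  next-≡ n y y+1≡n with suc y ≡ᵇ n in eq
  ... | true  = refl
  ... | false = ⊥-elim (subst T eq (≡⇒≡ᵇ (suc y) n y+1≡n))

  prev<n : ∀ n y → y < n → prev n y < n
  prev<n (suc n) zero    _   = s≤s ≤-refl
  prev<n n       (suc y) y<n = <-trans (n<1+n y) y<n

  next<n : ∀ n y → y < n → next n y < n
  next<n n y y<n with m≤n⇒m<n∨m≡n y<n
  ... | inj₁ y+1<n = subst (_< n) (sym (next-< n y y+1<n)) y+1<n
  ... | inj₂ y+1≡n = subst (_< n) (sym (next-≡ n y y+1≡n)) (≤-trans (s≤s z≤n) y<n)

  prev-next : ∀ n y → y < n → prev n (next n y) ≡ y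
  prev-next n y y<n with m≤n⇒m<n∨m≡n y<n
  ... | inj₁ y+1<n = cong (prev n) (next-< n y y+1<n)
  ... | inj₂ y+1≡n = trans (cong (prev n) (next-≡ n y y+1≡n)) (cong (_∸ 1) (sym y+1≡n))

  next-prev : ∀ n y → y < n → next n (prev n y) ≡ y
  next-prev (suc n) zero    _   = next-≡ (suc n) n refl
  next-prev n       (suc y) y<n = next-< n y y<n

  -- adjacency in Cₙ, exactly as in Defs.cycAdj but on the underlying numbers
  succModℕ : ℕ → ℕ → ℕ → Bool
  succModℕ n x y = (suc x ≡ᵇ y) ∨ ((suc x ≡ᵇ n) ∧ (y ≡ᵇ 0))

  adjacentℕ : ℕ → ℕ → ℕ → Bool
  adjacentℕ n x y = (succModℕ n x y ∨ succModℕ n y x) ∧ not (x ≡ᵇ y)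

  adjacent⇒neighbour : ∀ n x y → x < n → T (adjacentℕ n x y) → x ≡ prev n y ⊎ x ≡ next n y
  adjacent⇒neighbour n x y x<n adj with ∨-elim (proj₁ (∧-elim {succModℕ n x y ∨ succModℕ n y x} adj))
  ... | inj₁ s with ∨-elim {suc x ≡ᵇ y} s
  ...   | inj₁ e with refl ← ≡ᵇ⇒≡ (suc x) y e = inj₁ refl
  ...   | inj₂ e with ∧-elim {suc x ≡ᵇ n} e
  ...     | (e₁ , e₂) with refl ← ≡ᵇ⇒≡ (suc x) n e₁ | refl ← ≡ᵇ⇒≡ y 0 e₂ = inj₁ refl
  adjacent⇒neighbour n x y x<n adj | inj₂ s with ∨-elim {suc y ≡ᵇ x} s
  ...   | inj₁ e with refl ← ≡ᵇ⇒≡ (suc y) x e = inj₂ (sym (next-< n y x<n))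
  ...   | inj₂ e with ∧-elim {suc y ≡ᵇ n} e
  ...     | (e₁ , e₂) = inj₂ (trans (≡ᵇ⇒≡ x 0 e₂) (sym (next-≡ n y (≡ᵇ⇒≡ (suc y) n e₁))))

  private
    n≢1+n : ∀ (y : ℕ) → y ≢ suc y
    n≢1+n zero    ()
    n≢1+n (suc y) e = n≢1+n y (suc-injective e)

  neighbour⇒adjacent : ∀ n x y → 3 ≤ n → x ≡ prev n y ⊎ x ≡ next n y → T (adjacentℕ n x y)
  neighbour⇒adjacent (suc n) x zero 3≤n (inj₁ refl) =
    ∧-intro (∨-inl (∨-inr {suc n ≡ᵇ 0} (∧-intro (≡⇒≡ᵇ (suc n) (suc n) refl) tt)))
            (≢⇒not≡ᵇ {n} λ n≡0 → ≤⇒≯ 3≤n (subst (λ z → suc z < 3) (sym n≡0) (s≤s (s≤s z≤n))))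
  neighbour⇒adjacent n x (suc y) 3≤n (inj₁ refl) =
    ∧-intro (∨-inl (∨-inl (≡⇒≡ᵇ (suc x) (suc x) refl))) (≢⇒not≡ᵇ (n≢1+n x))
  neighbour⇒adjacent n x y 3≤n (inj₂ refl) with suc y ≡ᵇ n in eq
  ... | true  = ∧-intro (∨-inr {succModℕ n 0 y} (∨-inr (∧-intro (subst T (sym eq) tt) tt)))
                        (≢⇒not≡ᵇ λ y≡0 → ≤⇒≯ 3≤n (subst (_< 3) (≡ᵇ⇒≡ (suc y) n (subst T (sym eq) tt))
                                                    (subst (λ z → suc z < 3) y≡0 (s≤s (s≤s z≤n)))))
  ... | false = ∧-intro (∨-inr {succModℕ n (suc y) y} (∨-inl (≡⇒≡ᵇ (suc y) (suc y) refl)))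
                        (≢⇒not≡ᵇ λ e → n≢1+n y (sym e))

  row-same : ∀ {i′ i : Row} → T (finEq i′ i) → i′ ≡ i
  row-same {i′} {i} e = toℕ-injective (≡ᵇ⇒≡ (toℕ i′) (toℕ i) e)

  row-distinct : ∀ {i′ i : Row} → T (not (finEq i′ i)) → i′ ≡ other i
  row-distinct {zero}     {zero}     ()
  row-distinct {zero}     {suc zero} _ = refl
  row-distinct {suc zero} {zero}     _ = refl
  row-distinct {suc zero} {suc zero} ()

  finEq-refl : ∀ {k} (i : Fin k) → T (finEq i i)
  finEq-refl i = ≡⇒≡ᵇ (toℕ i) (toℕ i) refl

  other-distinct : ∀ i → T (not (finEq (other i) i))
  other-distinct zero       = tt
  other-distinct (suc zero) = tt

  vertex∈ : ∀ n (i : Row) (j : Fin n) → (i , j) ∈ vertices (P₂□C n)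
  vertex∈ n zero       j = ∈-++⁺ˡ (∈-map⁺ (λ j → (zero , j)) (∈-allFin j))
  vertex∈ n (suc zero) j = ∈-++⁺ʳ (map (λ j → (zero , j)) (allFin n))
                                  (∈-++⁺ˡ (∈-map⁺ (λ j → (suc zero , j)) (∈-allFin j)))

  -- a list of columns indexed by position (the default column is never used)
  colAt : List Col → ℕ → Col
  colAt []       _       = (false , false)
  colAt (x ∷ xs) zero    = x
  colAt (x ∷ xs) (suc k) = colAt xs k

  lookup≡colAt : ∀ {n} (u : Vec Col n) (j : Fin n) → lookup u j ≡ colAt (toList u) (toℕ j)
  lookup≡colAt (x ∷ u) zero    = refl
  lookup≡colAt (x ∷ u) (suc j) = lookup≡colAt u j

  module Ladder (n : ℕ) (3≤n : 3 ≤ n) (u : Vec Col n) where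

    G : FinGraph
    G = P₂□C n

    D : VSet G
    D = (Vec.map proj₁ u , Vec.map proj₂ u)

    U : ℕ → Col
    U = colAt (toList u)

    dominatedAt : Fin 2 × Fin n → Bool
    dominatedAt v = mem G D v ∨ any (λ x → mem G D x ∧ adj G x v) (vertices G)

    locallyCovered : ℕ → Bool
    locallyCovered y = covered (U (prev n y)) (U y) (U (next n y))

    rowCovered : Row → ℕ → Bool
    rowCovered i y = coversRow i (U (prev n y)) (U y) (U (next n y))

    mem≡bit : ∀ i j → mem G D (i , j) ≡ bit i (U (toℕ j))
    mem≡bit zero       j = trans (lookup-map j proj₁ u) (cong proj₁ (lookup≡colAt u j))
    mem≡bit (suc zero) j = trans (lookup-map j proj₂ u) (cong proj₂ (lookup≡colAt u j))

    bit⇒mem : ∀ i k (k<n : k < n) → T (bit i (U k)) → T (mem G D (i , fromℕ< k<n))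
    bit⇒mem i k k<n b = subst T (sym (mem≡bit i (fromℕ< k<n)))
                                (subst (λ z → T (bit i (U z))) (sym (toℕ-fromℕ< k<n)) b)

    dominated⇒covered : ∀ i j → T (dominatedAt (i , j)) → T (rowCovered i (toℕ j))
    dominated⇒covered i j d with ∨-elim {mem G D (i , j)} d
    ... | inj₁ m = ∨-inl (subst T (mem≡bit i j) m)
    ... | inj₂ a with satisfied (any⁻ _ (vertices G) a)
    ...   | ((i′ , j′) , h) with ∧-elim {mem G D (i′ , j′)} h
    ...     | (m′ , adj′) with ∨-elim {finEq i′ i ∧ cycAdj n j′ j} adj′
    ...       | inj₂ same-column with ∧-elim {finEq j′ j} same-column
    ...         | (j′≡j , i′≢i) with refl ← toℕ-injective (≡ᵇ⇒≡ (toℕ j′) (toℕ j) j′≡j)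
                                   | refl ← row-distinct {i′} {i} i′≢i =
      ∨-inr {bit i (U (toℕ j))} (∨-inl (subst T (mem≡bit (other i) j) m′))
    dominated⇒covered i j d | inj₂ a | ((i′ , j′) , h) | (m′ , adj′) | inj₁ same-row
      with ∧-elim {finEq i′ i} same-row
    ... | (i′≡i , cyc) with refl ← row-same {i′} {i} i′≡i
                          | adjacent⇒neighbour n (toℕ j′) (toℕ j) (toℕ<n j′) cyc
    ... | inj₁ j′≡prev = ∨-inr {bit i (U (toℕ j))} (∨-inr {bit (other i) (U (toℕ j))} (∨-inl
                           (subst (λ z → T (bit i (U z))) j′≡prev (subst T (mem≡bit i j′) m′))))
    ... | inj₂ j′≡next = ∨-inr {bit i (U (toℕ j))} (∨-inr {bit (other i) (U (toℕ j))} (∨-inr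
                           {bit i (U (prev n (toℕ j)))}
                           (subst (λ z → T (bit i (U z))) j′≡next (subst T (mem≡bit i j′) m′))))

    private
      dominatedBy : ∀ {x} v → T (mem G D x) → T (adj G x v) → T (dominatedAt v)
      dominatedBy {x} v m a = ∨-inr {mem G D v}
        (any⁺ (λ x → mem G D x ∧ adj G x v) (lose (vertex∈ n (proj₁ x) (proj₂ x)) (∧-intro m a)))

      cycle-neighbour : ∀ i j k (k<n : k < n) → k ≡ prev n (toℕ j) ⊎ k ≡ next n (toℕ j) →
                        T (adj G (i , fromℕ< k<n) (i , j))
      cycle-neighbour i j k k<n nb = ∨-inl (∧-intro (finEq-refl i)
        (neighbour⇒adjacent n (toℕ (fromℕ< k<n)) (toℕ j) 3≤n
          (subst (λ z → z ≡ prev n (toℕ j) ⊎ z ≡ next n (toℕ j)) (sym (toℕ-fromℕ< k<n)) nb)))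

    covered⇒dominated : ∀ i j → T (rowCovered i (toℕ j)) → T (dominatedAt (i , j))
    covered⇒dominated i j c with ∨-elim {bit i (U (toℕ j))} c
    ... | inj₁ self = ∨-inl (subst T (sym (mem≡bit i j)) self)
    ... | inj₂ c₁ with ∨-elim {bit (other i) (U (toℕ j))} c₁
    ...   | inj₁ opposite = dominatedBy {other i , j} (i , j) (subst T (sym (mem≡bit (other i) j)) opposite)
                              (∨-inr {finEq (other i) i ∧ cycAdj n j j}
                                     (∧-intro (finEq-refl j) (other-distinct i)))
    ...   | inj₂ c₂ with ∨-elim {bit i (U (prev n (toℕ j)))} c₂
    ...     | inj₁ left  = let p = prev<n n (toℕ j) (toℕ<n j) in
                           dominatedBy {i , fromℕ< p} (i , j) (bit⇒mem i _ p left) (cycle-neighbour i j _ p (inj₁ refl))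
    ...     | inj₂ right = let p = next<n n (toℕ j) (toℕ<n j) in
                           dominatedBy {i , fromℕ< p} (i , j) (bit⇒mem i _ p right) (cycle-neighbour i j _ p (inj₂ refl))

    dominating⇒covered : T (isDominating G D) → ∀ y → y < n → T (locallyCovered y)
    dominating⇒covered d y y<n =
      ∧-intro (at-row zero) (at-row (suc zero))
      where
      at-row : ∀ i → T (rowCovered i y)
      at-row i = subst (λ z → T (rowCovered i z)) (toℕ-fromℕ< y<n)
        (dominated⇒covered i (fromℕ< y<n)
          (All.lookup (all⁺ dominatedAt (vertices G) d) (vertex∈ n i (fromℕ< y<n))))

    covered⇒dominating : (∀ y → y < n → T (locallyCovered y)) → T (isDominating G D)
    covered⇒dominating cov = all⁻ dominatedAt {vertices G} (All.tabulate λ {v} _ → at v)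
      where
      at : ∀ v → T (dominatedAt v)
      at (i , j) = covered⇒dominated i j (row i (∧-elim (cov (toℕ j) (toℕ<n j))))
        where
        row : ∀ i → T (rowCovered zero (toℕ j)) × T (rowCovered (suc zero) (toℕ j)) → T (rowCovered i (toℕ j))
        row zero       = proj₁
        row (suc zero) = proj₂

  private
    covered-cong : ∀ {a a′ b b′ c c′} → a ≡ a′ → b ≡ b′ → c ≡ c′ → T (covered a b c) → T (covered a′ b′ c′)
    covered-cong refl refl refl x = x

  chain⇒positions : ∀ {m} a b (w : Vec Col m) e₁ e₂ → T (chainCovered a b w e₁ e₂) →
    let M = colAt (a ∷ b ∷ (toList w ++ e₁ ∷ e₂ ∷ [])) in
    ∀ k → k < suc (suc m) → T (covered (M k) (M (suc k)) (M (suc (suc k))))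
  chain⇒positions a b []      e₁ e₂ c zero          _ = proj₁ (∧-elim {covered a b e₁} c)
  chain⇒positions a b []      e₁ e₂ c (suc zero)    _ = proj₂ (∧-elim {covered a b e₁} c)
  chain⇒positions a b []      e₁ e₂ c (suc (suc k)) (s≤s (s≤s ()))
  chain⇒positions a b (x ∷ w) e₁ e₂ c zero          _ = proj₁ (∧-elim {covered a b x} c)
  chain⇒positions a b (x ∷ w) e₁ e₂ c (suc k) (s≤s k<) =
    chain⇒positions b x w e₁ e₂ (proj₂ (∧-elim {covered a b x} c)) k k<

  positions⇒chain : ∀ {m} a b (w : Vec Col m) e₁ e₂ →
    let M = colAt (a ∷ b ∷ (toList w ++ e₁ ∷ e₂ ∷ [])) in
    (∀ k → k < suc (suc m) → T (covered (M k) (M (suc k)) (M (suc (suc k))))) → T (chainCovered a b w e₁ e₂)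
  positions⇒chain a b []      e₁ e₂ f = ∧-intro (f 0 (s≤s z≤n)) (f 1 (s≤s (s≤s z≤n)))
  positions⇒chain a b (x ∷ w) e₁ e₂ f =
    ∧-intro (f 0 (s≤s z≤n)) (positions⇒chain b x w e₁ e₂ (λ k k< → f (suc k) (s≤s k<)))

  colAt-++ˡ : ∀ {n} (u : Vec Col n) ys k → k < n → colAt (toList u ++ ys) k ≡ colAt (toList u) k
  colAt-++ˡ (x ∷ u) ys zero    _        = refl
  colAt-++ˡ (x ∷ u) ys (suc k) (s≤s k<) = colAt-++ˡ u ys k k<

  colAt-++ʳ : ∀ {n} (u : Vec Col n) ys i → colAt (toList u ++ ys) (n + i) ≡ colAt ys i
  colAt-++ʳ []      ys i = refl
  colAt-++ʳ (x ∷ u) ys i = colAt-++ʳ u ys i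

  -- A cyclic word u = u₀ u₁ w is read as the linear list u u₀ u₁: position
  -- k, k + 1, k + 2 of that list are positions k, next k, next (next k) of u.
  module Cyclic (m : ℕ) (3≤n : 3 ≤ suc (suc m)) (u₀ u₁ : Col) (w : Vec Col m) where

    n : ℕ
    n = suc (suc m)

    u : Vec Col n
    u = u₀ ∷ u₁ ∷ w

    U M : ℕ → Col
    U = colAt (toList u)
    M = colAt (toList u ++ u₀ ∷ u₁ ∷ [])

    M≡U : ∀ k → k < n → M k ≡ U k
    M≡U k k<n = colAt-++ˡ u (u₀ ∷ u₁ ∷ []) k k<n

    M-next : ∀ k → k < n → M (suc k) ≡ U (next n k)
    M-next k k<n with m≤n⇒m<n∨m≡n k<n
    ... | inj₁ k+1<n = trans (M≡U (suc k) k+1<n) (cong U (sym (next-< n k k+1<n)))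
    ... | inj₂ k+1≡n = trans (cong M (trans k+1≡n (sym (+-identityʳ n))))
                             (trans (colAt-++ʳ u (u₀ ∷ u₁ ∷ []) 0) (cong U (sym (next-≡ n k k+1≡n))))

    M-next² : ∀ k → k < n → M (suc (suc k)) ≡ U (next n (next n k))
    M-next² k k<n with m≤n⇒m<n∨m≡n k<n
    ... | inj₁ k+1<n = trans (M-next (suc k) k+1<n) (cong (λ z → U (next n z)) (sym (next-< n k k+1<n)))
    ... | inj₂ k+1≡n = trans (cong M (trans (cong suc k+1≡n) (sym (+-comm n 1))))
                             (trans (colAt-++ʳ u (u₀ ∷ u₁ ∷ []) 1)
                               (cong U (sym (trans (cong (next n) (next-≡ n k k+1≡n))
                                                   (next-< n 0 (≤-trans (s≤s (s≤s z≤n)) 3≤n))))))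

    open Ladder n 3≤n u using (locallyCovered)

    cyclic⇒covered : T (cyclicCovered u) → ∀ y → y < n → T (locallyCovered y)
    cyclic⇒covered c y y<n =
      let k = prev n y ; k<n = prev<n n y y<n in
      covered-cong (M≡U k k<n) (trans (M-next k k<n) (cong U (next-prev n y y<n)))
                   (trans (M-next² k k<n) (cong (λ z → U (next n z)) (next-prev n y y<n)))
                   (chain⇒positions u₀ u₁ w u₀ u₁ c k k<n)

    covered⇒cyclic : (∀ y → y < n → T (locallyCovered y)) → T (cyclicCovered u)
    covered⇒cyclic f = positions⇒chain u₀ u₁ w u₀ u₁ λ k k<n →
      covered-cong (trans (cong U (prev-next n k k<n)) (sym (M≡U k k<n))) (sym (M-next k k<n)) (sym (M-next² k k<n))
                   (f (next n k) (next<n n k k<n))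

  dominating≡cyclicCovered : ∀ m (3≤n : 3 ≤ suc (suc m)) (u : Vec Col (suc (suc m))) →
    isDominating (P₂□C (suc (suc m))) (Vec.map proj₁ u , Vec.map proj₂ u) ≡ cyclicCovered u
  dominating≡cyclicCovered m 3≤n (u₀ ∷ u₁ ∷ w) =
    T-ext (λ d → covered⇒cyclic (dominating⇒covered d)) (λ c → covered⇒dominating (cyclic⇒covered c))
    where
    open Cyclic m 3≤n u₀ u₁ w
    open Ladder n 3≤n u using (dominating⇒covered; covered⇒dominating)

module CountingByTrace where

  open import Data.Bool using (true; false)
  open import Data.Nat using (ℕ; suc; _+_; _≤_; _≟_)
  open import Data.Nat.Properties
  open import Data.Product using (_,_; proj₁; proj₂)
  open import Data.List using ([]; _++_; map; allFin; length; filter)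
  open import Data.List.Properties using (length-++; length-map; length-tabulate)
  open import Data.Vec using (Vec; []; _∷_)
  import Data.Vec as Vec
  open import Data.Fin using (Fin)
  import Data.Fin as Fin
  open import Data.Fin.Subset using (∣_∣)
  open import Relation.Binary.PropositionalEquality
  open MinCountSemiring
  open TransferMatrix
  open Sums
  open MinimumAndCount using (Summary; summary)
  open Domination using (dominating≡cyclicCovered)
  open Defs

  size≡wordWeight : ∀ {n} (u : Vec Col n) → ∣ Vec.map proj₁ u ∣ + ∣ Vec.map proj₂ u ∣ ≡ wordWeight u
  size≡wordWeight []                 = refl
  size≡wordWeight ((true , true) ∷ u) = cong suc (trans (+-suc _ _) (cong suc (size≡wordWeight u)))
  size≡wordWeight ((true , false) ∷ u) = cong suc (size≡wordWeight u)
  size≡wordWeight ((false , true) ∷ u) = trans (+-suc _ _) (cong suc (size≡wordWeight u))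
  size≡wordWeight ((false , false) ∷ u) = size≡wordWeight u

  vertex-count : ∀ n → length (vertices (P₂□C n)) ≡ n + (n + 0)
  vertex-count n =
    trans (length-++ (map row₀ (allFin n)) {map row₁ (allFin n) ++ []})
          (cong₂ _+_ (row-length row₀) (trans (length-++ (map row₁ (allFin n)) {[]}) (cong (_+ 0) (row-length row₁))))
    where
    row₀ row₁ : Fin n → Fin 2 × Fin n
    row₀ j = (Fin.zero , j)
    row₁ j = (Fin.suc Fin.zero , j)
    row-length : (f : Fin n → Fin 2 × Fin n) → length (map f (allFin n)) ≡ n
    row-length f = trans (length-map f (allFin n)) (length-tabulate (λ x → x))

  module _ (m : ℕ) (3≤n : 3 ≤ suc (suc m)) where

    private
      n = suc (suc m)
      G = P₂□C n

    dominating-sum : sumList (λ D → val (size G D) 1) (dominatingSets G) ≡ trace (R m)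
    dominating-sum = begin
        sumList (λ D → val (size G D) 1) (dominatingSets G)
      ≡⟨ sym (sumList-filter (isDominating G) (λ D → val (size G D) 1) (subsets G)) ⟩
        sumList H (subsets G)
      ≡⟨ sumList-concatMap H (λ s → map (λ t → (s , t)) (allSubsets n)) (allSubsets n) ⟩
        sumList (λ s → sumList H (map (λ t → (s , t)) (allSubsets n))) (allSubsets n)
      ≡⟨ sumList-cong (λ s → trans (sumList-map H (λ t → (s , t)) (allSubsets n))
                                   (sumList-allSubsets n (λ t → H (s , t)))) (allSubsets n) ⟩
        sumList (λ s → sumSubsets n (λ t → H (s , t))) (allSubsets n)
      ≡⟨ sumList-allSubsets n (λ s → sumSubsets n (λ t → H (s , t))) ⟩
        sumSubsets n (λ s → sumSubsets n (λ t → H (s , t)))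
      ≡⟨ sumSubsets-pairs n (λ s t → H (s , t)) ⟩
        sumWords n (λ u → H (Vec.map proj₁ u , Vec.map proj₂ u))
      ≡⟨ sumWords-cong n (λ u → cong₂ keepIf (dominating≡cyclicCovered m 3≤n u)
                                            (cong (λ z → val z 1) (size≡wordWeight u))) ⟩
        sumWords n (λ u → keepIf (cyclicCovered u) (val (wordWeight u) 1))
      ≡⟨ cycle-sum m ⟩
        trace (R m)
      ∎
      where
      open ≡-Reasoning
      H : VSet G → MinCount
      H D = keepIf (isDominating G D) (val (size G D) 1)

    -- hence the trace determines γ and τ; the bound g ≤ n keeps g below the
    -- initial value |V| = 2n of the fold that defines Defs.γ
    τ-from-trace : ∀ {g c} → trace (R m) ≡ val g c → g ≤ n → τ G ≡ c
    τ-from-trace {g} {c} tr≡ g≤n =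
      trans (cong (λ x → length (filter (λ D → size G D ≟ x) (dominatingSets G))) γ≡g) count-min
      where
      S : Summary (size G) (dominatingSets G) g c
      S = summary (size G) (dominatingSets G) (trans dominating-sum tr≡)
      open Summary S
      γ≡g : γ G ≡ g
      γ≡g = trans (fold-min (length (vertices G)))
                  (m≤n⇒m⊓n≡m (≤-trans g≤n (subst (n ≤_) (sym (vertex-count n)) (m≤m+n n (n + 0)))))

-- Tables over the sixteen pairs of columns, stored as data so that iterating
-- the transfer step evaluates each entry once.
module Tables where

  open import Data.Bool using (Bool; true; false; _∧_)
  open import Data.Bool.Properties using (∧-conicalˡ; ∧-conicalʳ)
  open import Data.Nat using (ℕ; zero; suc)
  open import Data.Product using (_,_)
  open import Relation.Binary.PropositionalEquality
  open MinCountSemiring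
  open TransferMatrix

  record Four (A : Set) : Set where
    constructor four
    field ⟨tt⟩ ⟨tf⟩ ⟨ft⟩ ⟨ff⟩ : A

  at : {A : Set} → Four A → Col → A
  at (four x _ _ _) (true  , true)  = x
  at (four _ x _ _) (true  , false) = x
  at (four _ _ x _) (false , true)  = x
  at (four _ _ _ x) (false , false) = x

  tab : {A : Set} → (Col → A) → Four A
  tab f = four (f (true , true)) (f (true , false)) (f (false , true)) (f (false , false))

  zip₃ : {A B C D : Set} → (A → B → C → D) → Four A → Four B → Four C → Four D
  zip₃ f (four x₁ x₂ x₃ x₄) (four y₁ y₂ y₃ y₄) (four z₁ z₂ z₃ z₄) =
    four (f x₁ y₁ z₁) (f x₂ y₂ z₂) (f x₃ y₃ z₃) (f x₄ y₄ z₄)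

  map₄ : {A B : Set} → (A → B) → Four A → Four B
  map₄ f (four x₁ x₂ x₃ x₄) = four (f x₁) (f x₂) (f x₃) (f x₄)

  at-tab : {A : Set} (f : Col → A) → ∀ c → at (tab f) c ≡ f c
  at-tab f (true  , true)  = refl
  at-tab f (true  , false) = refl
  at-tab f (false , true)  = refl
  at-tab f (false , false) = refl

  at-map₄ : {A B : Set} (f : A → B) (x : Four A) → ∀ c → at (map₄ f x) c ≡ f (at x c)
  at-map₄ f (four _ _ _ _) (true  , true)  = refl
  at-map₄ f (four _ _ _ _) (true  , false) = refl
  at-map₄ f (four _ _ _ _) (false , true)  = refl
  at-map₄ f (four _ _ _ _) (false , false) = refl

  Table : Set → Set
  Table A = Four (Four (Four (Four A)))

  -- reading and storing a table; `put` evaluates nothing, but once a stored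
  -- table is computed its entries are shared by every later lookup
  get : {A : Set} → Table A → Tab A
  get M a b e₁ e₂ = at (at (at (at M a) b) e₁) e₂

  put : {A : Set} → Tab A → Table A
  put X = tab λ a → tab λ b → tab λ e₁ → tab λ e₂ → X a b e₁ e₂

  mapTable : {A B : Set} → (A → B) → Table A → Table B
  mapTable f = map₄ (map₄ (map₄ (map₄ f)))

  zipTable₃ : {A B C D : Set} → (A → B → C → D) → Table A → Table B → Table C → Table D
  zipTable₃ f = zip₃ (zip₃ (zip₃ (zip₃ f)))

  get-put : {A : Set} (X : Tab A) → ∀ a b e₁ e₂ → get (put X) a b e₁ e₂ ≡ X a b e₁ e₂
  get-put X a b e₁ e₂ = begin
    at (at (at (at (put X) a) b) e₁) e₂
      ≡⟨ cong (λ t → at (at (at t b) e₁) e₂) (at-tab (λ a → tab λ b → tab λ e₁ → tab λ e₂ → X a b e₁ e₂) a) ⟩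
    at (at (at (tab λ b → tab λ e₁ → tab λ e₂ → X a b e₁ e₂) b) e₁) e₂
      ≡⟨ cong (λ t → at (at t e₁) e₂) (at-tab (λ b → tab λ e₁ → tab λ e₂ → X a b e₁ e₂) b) ⟩
    at (at (tab λ e₁ → tab λ e₂ → X a b e₁ e₂) e₁) e₂
      ≡⟨ cong (λ t → at t e₂) (at-tab (λ e₁ → tab λ e₂ → X a b e₁ e₂) e₁) ⟩
    at (tab λ e₂ → X a b e₁ e₂) e₂
      ≡⟨ at-tab (X a b e₁) e₂ ⟩
    X a b e₁ e₂
      ∎
    where open ≡-Reasoning

  get-map : {A B : Set} (f : A → B) (M : Table A) → ∀ a b e₁ e₂ →
            get (mapTable f M) a b e₁ e₂ ≡ f (get M a b e₁ e₂)
  get-map f M a b e₁ e₂ = begin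
    at (at (at (at (mapTable f M) a) b) e₁) e₂
      ≡⟨ cong (λ t → at (at (at t b) e₁) e₂) (at-map₄ (map₄ (map₄ (map₄ f))) M a) ⟩
    at (at (at (map₄ (map₄ (map₄ f)) (at M a)) b) e₁) e₂
      ≡⟨ cong (λ t → at (at t e₁) e₂) (at-map₄ (map₄ (map₄ f)) (at M a) b) ⟩
    at (at (map₄ (map₄ f) (at (at M a) b)) e₁) e₂
      ≡⟨ cong (λ t → at t e₂) (at-map₄ (map₄ f) (at (at M a) b) e₁) ⟩
    at (map₄ f (at (at (at M a) b) e₁)) e₂
      ≡⟨ at-map₄ f (at (at (at M a) b) e₁) e₂ ⟩
    f (get M a b e₁ e₂)
      ∎
    where open ≡-Reasoning

  -- Boolean equality of stored tables, sound whenever the entry test is;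
  -- certificates are stated as such tests, which evaluate in one pass
  sameFour : {A : Set} → (A → A → Bool) → Four A → Four A → Bool
  sameFour same (four x₁ x₂ x₃ x₄) (four y₁ y₂ y₃ y₄) = same x₁ y₁ ∧ same x₂ y₂ ∧ same x₃ y₃ ∧ same x₄ y₄

  Sound : {A : Set} → (A → A → Bool) → Set
  Sound {A} same = ∀ (x y : A) → same x y ≡ true → x ≡ y

  sameFour-sound : {A : Set} {same : A → A → Bool} → Sound same → Sound (sameFour same)
  sameFour-sound {same = same} sound (four x₁ x₂ x₃ x₄) (four y₁ y₂ y₃ y₄) e
    with refl ← sound x₁ y₁ (∧-conicalˡ _ _ e)
       | refl ← sound x₂ y₂ (∧-conicalˡ _ _ (∧-conicalʳ (same x₁ y₁) _ e))
       | refl ← sound x₃ y₃ (∧-conicalˡ _ _ (∧-conicalʳ (same x₂ y₂) _ (∧-conicalʳ (same x₁ y₁) _ e)))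
       | refl ← sound x₄ y₄ (∧-conicalʳ (same x₃ y₃) _ (∧-conicalʳ (same x₂ y₂) _ (∧-conicalʳ (same x₁ y₁) _ e)))
    = refl

  sameTable : {A : Set} → (A → A → Bool) → Table A → Table A → Bool
  sameTable same = sameFour (sameFour (sameFour (sameFour same)))

  sameTable-sound : {A : Set} {same : A → A → Bool} → Sound same → Sound (sameTable same)
  sameTable-sound sound = sameFour-sound (sameFour-sound (sameFour-sound (sameFour-sound sound)))

  Rtable : ℕ → Table MinCount
  Rtable zero    = put closing
  Rtable (suc m) = put (step (get (Rtable m)))

  Rtable-correct : ∀ m → get (Rtable m) ≈ R m
  Rtable-correct zero            = get-put closing
  Rtable-correct (suc m) a b e₁ e₂ =
    trans (get-put (step (get (Rtable m))) a b e₁ e₂) (step-cong (Rtable-correct m) a b e₁ e₂)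

-- Families of table entries indexed by a period k ∈ ℕ:
-- `family c a b d` stands for  val (2k + c) (a + b·k + d·T(k)),  where
-- T(k) = 0 + 1 + … + (k - 1), and `never` for `none` at every k.
module PeriodicFamilies where

  open import Data.Bool using (Bool; true; false; _∧_; if_then_else_)
  open import Data.Bool.Properties using (∧-conicalˡ; ∧-conicalʳ)
  open import Data.Nat using (ℕ; zero; suc; _+_; _*_; _∸_; _<ᵇ_; _≡ᵇ_)
  open import Data.Nat.Tactic.RingSolver using (solve-∀)
  open import Relation.Binary.PropositionalEquality
  open MinCountSemiring
  open TransferMatrix
  open Tables

  triangle : ℕ → ℕ
  triangle zero    = 0
  triangle (suc k) = triangle k + k

  data Family : Set where
    never  : Family
    family : (c a b d : ℕ) → Family

  atPeriod : ℕ → Family → MinCount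
  atPeriod k never            = none
  atPeriod k (family c a b d) = val (2 * k + c) (a + b * k + d * triangle k)

  advance : Family → Family
  advance never            = never
  advance (family c a b d) = family (c + 2) (a + b) (b + d) d

  -- union and scaling of families, computed coefficientwise; union compares
  -- the constants c, since at every period both weights are shifted by 2k
  _⊕ᶠ_ : Family → Family → Family
  never            ⊕ᶠ y                   = y
  family c a b d   ⊕ᶠ never               = family c a b d
  family c a b d   ⊕ᶠ family c′ a′ b′ d′ =
    if c <ᵇ c′ then family c a b d
    else (if c′ <ᵇ c then family c′ a′ b′ d′ else family c (a + a′) (b + b′) (d + d′))

  _▷ᶠ_ : MinCount → Family → Family
  none    ▷ᶠ _                = never
  val _ _ ▷ᶠ never            = never
  val w n ▷ᶠ family c a b d   = family (w + c) (n * a) (n * b) (n * d)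

  private
    <ᵇ-shift : ∀ p a b → ((p + a) <ᵇ (p + b)) ≡ (a <ᵇ b)
    <ᵇ-shift zero    a b = refl
    <ᵇ-shift (suc p) a b = <ᵇ-shift p a b

  atPeriod-⊕ : ∀ k x y → atPeriod k (x ⊕ᶠ y) ≡ atPeriod k x ⊕ atPeriod k y
  atPeriod-⊕ k never            y                     = refl
  atPeriod-⊕ k (family c a b d) never                 = refl
  atPeriod-⊕ k (family c a b d) (family c′ a′ b′ d′)
    rewrite <ᵇ-shift (2 * k) c c′ | <ᵇ-shift (2 * k) c′ c with c <ᵇ c′ | c′ <ᵇ c
  ... | true  | _     = refl
  ... | false | true  = refl
  ... | false | false = cong (val (2 * k + c)) (count-eq a b d a′ b′ d′ k (triangle k))
    where
    count-eq : ∀ a b d a′ b′ d′ k t →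
      (a + a′) + (b + b′) * k + (d + d′) * t ≡ (a + b * k + d * t) + (a′ + b′ * k + d′ * t)
    count-eq = solve-∀

  atPeriod-▷ : ∀ k s x → atPeriod k (s ▷ᶠ x) ≡ s ⊗ atPeriod k x
  atPeriod-▷ k none      x                = refl
  atPeriod-▷ k (val w n) never            = refl
  atPeriod-▷ k (val w n) (family c a b d) = cong₂ val (weight-eq k c w) (count-eq n a b d k (triangle k))
    where
    weight-eq : ∀ k c w → 2 * k + (w + c) ≡ w + (2 * k + c)
    weight-eq = solve-∀
    count-eq : ∀ n a b d k t → n * a + n * b * k + n * d * t ≡ n * (a + b * k + d * t)
    count-eq = solve-∀

  atPeriod-advance : ∀ k x → atPeriod (suc k) x ≡ atPeriod k (advance x)
  atPeriod-advance k never            = refl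
  atPeriod-advance k (family c a b d) = cong₂ val (weight-eq k c) (count-eq a b d k (triangle k))
    where
    weight-eq : ∀ k c → 2 * (1 + k) + c ≡ 2 * k + (c + 2)
    weight-eq = solve-∀
    count-eq : ∀ a b d k t → a + b * (1 + k) + d * (t + k) ≡ (a + b) + (b + d) * k + d * t
    count-eq = solve-∀

  module Fam = Transfer _⊕ᶠ_ _▷ᶠ_

  module AtPeriod (k : ℕ) =
    TransferHom {_⊞′_ = _⊕_} {_▷′_ = _⊗_} (atPeriod k) (atPeriod-⊕ k) (atPeriod-▷ k)

  stepsᶠ : ℕ → Table Family → Table Family
  stepsᶠ zero    M = M
  stepsᶠ (suc r) M = put (Fam.step (get (stepsᶠ r M)))

  -- fitting a family through three consecutive periods; only a guess, whose
  -- correctness is checked by the two certificates below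
  fit : MinCount → MinCount → MinCount → Family
  fit (val c x₀) (val _ x₁) (val _ x₂) = family c x₀ (x₁ ∸ x₀) (x₂ + x₀ ∸ 2 * x₁)
  fit _          _          _          = never

  start : Table Family
  start = zipTable₃ fit (Rtable 11) (Rtable 15) (Rtable 19)

  sameFamily : Family → Family → Bool
  sameFamily never            never                = true
  sameFamily (family c a b d) (family c′ a′ b′ d′) = (c ≡ᵇ c′) ∧ (a ≡ᵇ a′) ∧ (b ≡ᵇ b′) ∧ (d ≡ᵇ d′)
  sameFamily _                _                    = false

  sameFamily-sound : Sound sameFamily
  sameFamily-sound never            never                _ = refl
  sameFamily-sound (family c a b d) (family c′ a′ b′ d′) e
    with refl ← ≡ᵇ-sound {c} (∧-conicalˡ _ _ e)
       | refl ← ≡ᵇ-sound {a} (∧-conicalˡ _ _ (∧-conicalʳ (c ≡ᵇ c′) _ e))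
       | refl ← ≡ᵇ-sound {b} (∧-conicalˡ _ _ (∧-conicalʳ (a ≡ᵇ a′) _ (∧-conicalʳ (c ≡ᵇ c′) _ e)))
       | refl ← ≡ᵇ-sound {d} (∧-conicalʳ (b ≡ᵇ b′) _ (∧-conicalʳ (a ≡ᵇ a′) _ (∧-conicalʳ (c ≡ᵇ c′) _ e)))
    = refl

  start-base : sameTable sameMinCount (mapTable (atPeriod 0) start) (Rtable 11) ≡ true
  start-base = refl

  start-period : sameTable sameFamily (stepsᶠ 4 start) (mapTable advance start) ≡ true
  start-period = refl

  residue-steps : ∀ k → R (k * 4 + 11) ≈ AtPeriod.mapTab k (get start) →
                  ∀ r → R ((r + k * 4) + 11) ≈ AtPeriod.mapTab k (get (stepsᶠ r start))
  residue-steps k start-k zero    = start-k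
  residue-steps k start-k (suc r) a b e₁ e₂ = begin
      step (R ((r + k * 4) + 11)) a b e₁ e₂
    ≡⟨ step-cong (residue-steps k start-k r) a b e₁ e₂ ⟩
      step (mapTab (get (stepsᶠ r start))) a b e₁ e₂
    ≡⟨ sym (step-hom (get (stepsᶠ r start)) a b e₁ e₂) ⟩
      atPeriod k (Fam.step (get (stepsᶠ r start)) a b e₁ e₂)
    ≡⟨ cong (atPeriod k) (sym (get-put (Fam.step (get (stepsᶠ r start))) a b e₁ e₂)) ⟩
      atPeriod k (get (stepsᶠ (suc r) start) a b e₁ e₂)
    ∎
    where
    open ≡-Reasoning
    open AtPeriod k

  R-periodic : ∀ k → R (k * 4 + 11) ≈ AtPeriod.mapTab k (get start)
  R-periodic zero    a b e₁ e₂ = begin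
      R 11 a b e₁ e₂
    ≡⟨ sym (Rtable-correct 11 a b e₁ e₂) ⟩
      get (Rtable 11) a b e₁ e₂
    ≡⟨ cong (λ M → get M a b e₁ e₂) (sym (sameTable-sound sameMinCount-sound _ _ start-base)) ⟩
      get (mapTable (atPeriod 0) start) a b e₁ e₂
    ≡⟨ get-map (atPeriod 0) start a b e₁ e₂ ⟩
      atPeriod 0 (get start a b e₁ e₂)
    ∎
    where open ≡-Reasoning
  R-periodic (suc k) a b e₁ e₂ = begin
      R ((4 + k * 4) + 11) a b e₁ e₂
    ≡⟨ residue-steps k (R-periodic k) 4 a b e₁ e₂ ⟩
      atPeriod k (get (stepsᶠ 4 start) a b e₁ e₂)
    ≡⟨ cong (λ M → atPeriod k (get M a b e₁ e₂)) (sameTable-sound sameFamily-sound _ _ start-period) ⟩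
      atPeriod k (get (mapTable advance start) a b e₁ e₂)
    ≡⟨ cong (atPeriod k) (get-map advance start a b e₁ e₂) ⟩
      atPeriod k (advance (get start a b e₁ e₂))
    ≡⟨ sym (atPeriod-advance k (get start a b e₁ e₂)) ⟩
      atPeriod (suc k) (get start a b e₁ e₂)
    ∎
    where open ≡-Reasoning

  trace-residue : ∀ r k → trace (R ((r + k * 4) + 11)) ≡ atPeriod k (Fam.trace (get (stepsᶠ r start)))
  trace-residue r k = trans (trace-cong (residue-steps k (R-periodic k) r))
                            (sym (AtPeriod.trace-hom k (get (stepsᶠ r start))))

module Evaluation where

  open import Data.Bool using (Bool; true; false; _∧_; T)
  open import Data.Bool.Properties using (∧-conicalˡ; ∧-conicalʳ)
  open import Data.Nat using (ℕ; zero; suc; _+_; _*_; _∸_; _%_; _/_; _<_; _≤_; _≤?_; _≡ᵇ_; _≤ᵇ_; z≤n; s≤s)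
  open import Data.Nat.Properties
  open import Data.Nat.DivMod using (m≡m%n+[m/n]*n; m%n<n; [m+kn]%n≡m%n)
  open import Data.Nat.Tactic.RingSolver using (solve-∀)
  open import Relation.Binary.PropositionalEquality
  open import Relation.Nullary using (yes; no; contradiction)
  open import Data.Sum using (inj₁; inj₂)
  open MinCountSemiring
  open TransferMatrix
  open Tables using (get; Rtable; Rtable-correct)
  open PeriodicFamilies
  open CountingByTrace using (τ-from-trace)
  open Defs

  byResidue : ℕ → ℕ → ℕ
  byResidue 0 n = 4
  byResidue 1 n = 2 * n
  byResidue 2 n = n * (n + 2)
  byResidue _ n = 2 * n

  expected : ℕ → ℕ
  expected 3 = 9
  expected 6 = 51
  expected n = byResidue (n % 4) n

  expected-generic : ∀ n → n ≢ 3 → n ≢ 6 → expected n ≡ byResidue (n % 4) n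
  expected-generic 3 n≢3 _   = contradiction refl n≢3
  expected-generic 6 _   n≢6 = contradiction refl n≢6
  expected-generic 0                                 _ _ = refl
  expected-generic 1                                 _ _ = refl
  expected-generic 2                                 _ _ = refl
  expected-generic 4                                 _ _ = refl
  expected-generic 5                                 _ _ = refl
  expected-generic (suc (suc (suc (suc (suc (suc (suc n))))))) _ _ = refl

  data Size : ℕ → Set where
    small : ∀ i → i ≤ 9 → Size (3 + i)
    large : ∀ r k → r < 4 → Size ((13 + r) + k * 4)

  size-of : ∀ n → 3 ≤ n → Size n
  size-of (suc (suc zero)) (s≤s (s≤s ()))
  size-of (suc zero)       (s≤s ())
  size-of (suc (suc (suc i))) _ with i ≤? 9
  ... | yes i≤9 = small i i≤9
  ... | no  i≰9 = subst Size decomposition (large (d % 4) (d / 4) (m%n<n d 4))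
    where
    d = i ∸ 10
    decomposition : (13 + d % 4) + (d / 4) * 4 ≡ 3 + i
    decomposition = begin
      (13 + d % 4) + (d / 4) * 4  ≡⟨ +-assoc 13 (d % 4) _ ⟩
      13 + (d % 4 + (d / 4) * 4)  ≡⟨ cong (13 +_) (sym (m≡m%n+[m/n]*n d 4)) ⟩
      3 + (10 + d)                ≡⟨ cong (3 +_) (trans (+-comm 10 d) (m∸n+n≡m (≰⇒> i≰9))) ⟩
      3 + i                       ∎
      where open ≡-Reasoning

  smallCheck : ℕ → MinCount → Bool
  smallCheck n (val g c) = (c ≡ᵇ expected n) ∧ (g ≤ᵇ n)
  smallCheck n none      = false

  τ-via-table : ∀ m → 1 ≤ m → smallCheck (2 + m) (trace (get (Rtable m))) ≡ true →
                τ (P₂□C (2 + m)) ≡ expected (2 + m)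
  τ-via-table m 1≤m check with trace (get (Rtable m)) in tr
  ... | val g c = trans (τ-from-trace m (s≤s (s≤s 1≤m)) trace≡ g≤n) c≡expected
    where
    trace≡ : trace (R m) ≡ val g c
    trace≡ = trans (sym (trace-cong (Rtable-correct m))) tr
    c≡expected : c ≡ expected (2 + m)
    c≡expected = ≡ᵇ-sound (∧-conicalˡ _ _ check)
    g≤n : g ≤ 2 + m
    g≤n = ≤ᵇ⇒≤ g (2 + m) (subst T (sym (∧-conicalʳ (c ≡ᵇ expected (2 + m)) _ check)) _)

  upTo : (ℕ → Bool) → ℕ → Bool
  upTo p zero    = p zero
  upTo p (suc k) = upTo p k ∧ p (suc k)

  upTo-sound : ∀ p k → upTo p k ≡ true → ∀ i → i ≤ k → p i ≡ true
  upTo-sound p zero    all-p .zero z≤n = all-p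
  upTo-sound p (suc k) all-p i     i≤k with m≤n⇒m<n∨m≡n i≤k
  ... | inj₁ (s≤s i≤k′) = upTo-sound p k (∧-conicalˡ _ _ all-p) i i≤k′
  ... | inj₂ refl       = ∧-conicalʳ (upTo p k) _ all-p

  smallCase : ℕ → Bool
  smallCase i = smallCheck (3 + i) (trace (get (Rtable (1 + i))))

  small-checks : upTo smallCase 9 ≡ true
  small-checks = refl

  τ-small : ∀ i → i ≤ 9 → τ (P₂□C (3 + i)) ≡ expected (3 + i)
  τ-small i i≤9 = τ-via-table (1 + i) (s≤s z≤n) (upTo-sound smallCase 9 small-checks i i≤9)

  large-index : ∀ r k → 2 + ((r + k * 4) + 11) ≡ (13 + r) + k * 4
  large-index = solve-∀

  τ-periodic : ∀ r k {c a b d} → sameFamily (Fam.trace (get (stepsᶠ r start))) (family c a b d) ≡ true →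
               c ≤ 13 → τ (P₂□C ((13 + r) + k * 4)) ≡ a + b * k + d * triangle k
  τ-periodic r k {c} {a} {b} {d} certificate c≤13 =
    subst (λ n → τ (P₂□C n) ≡ a + b * k + d * triangle k) (large-index r k)
      (τ-from-trace ((r + k * 4) + 11) 3≤n trace≡ (subst (2 * k + c ≤_) (sym (large-index r k)) weight≤n))
    where
    3≤n : 3 ≤ 2 + ((r + k * 4) + 11)
    3≤n = s≤s (s≤s (≤-trans (s≤s z≤n) (m≤n+m 11 (r + k * 4))))
    trace≡ : trace (R ((r + k * 4) + 11)) ≡ val (2 * k + c) (a + b * k + d * triangle k)
    trace≡ = trans (trace-residue r k) (cong (atPeriod k) (sameFamily-sound _ _ certificate))
    reorder : 4 * k + (13 + r) ≡ (13 + r) + k * 4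
    reorder = trans (+-comm (4 * k) (13 + r)) (cong ((13 + r) +_) (*-comm 4 k))
    weight≤n : 2 * k + c ≤ (13 + r) + k * 4
    weight≤n = subst (2 * k + c ≤_) reorder
                 (+-mono-≤ (*-monoˡ-≤ k {2} {4} (s≤s (s≤s z≤n))) (≤-trans c≤13 (m≤m+n 13 r)))

  triangle-double : ∀ k → 2 * triangle k + k ≡ k * k
  triangle-double zero    = refl
  triangle-double (suc k) = begin
    2 * (triangle k + k) + suc k      ≡⟨ step₁ k (triangle k) ⟩
    (2 * triangle k + k) + 1 + 2 * k  ≡⟨ cong (λ z → z + 1 + 2 * k) (triangle-double k) ⟩
    k * k + 1 + 2 * k                 ≡⟨ step₂ k ⟩
    suc k * suc k                     ∎
    where
    open ≡-Reasoning
    step₁ : ∀ k t → 2 * (t + k) + suc k ≡ (2 * t + k) + 1 + 2 * k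
    step₁ = solve-∀
    step₂ : ∀ k → k * k + 1 + 2 * k ≡ suc k * suc k
    step₂ = solve-∀

  τ-residue : ∀ r k → r < 4 → τ (P₂□C ((13 + r) + k * 4)) ≡ byResidue ((13 + r) % 4) ((13 + r) + k * 4)
  τ-residue 0 k _ = trans (τ-periodic 0 k {7} {26} {8} {0} refl (≤ᵇ⇒≤ 7 13 _)) (count k (triangle k))
    where
    count : ∀ k t → 26 + 8 * k + 0 * t ≡ 2 * (13 + k * 4)
    count = solve-∀
  τ-residue 1 k _ = trans (τ-periodic 1 k {8} {224} {136} {32} refl (≤ᵇ⇒≤ 8 13 _)) (begin
      224 + 136 * k + 32 * triangle k          ≡⟨ regroup k (triangle k) ⟩
      224 + 120 * k + 16 * (2 * triangle k + k) ≡⟨ cong (λ z → 224 + 120 * k + 16 * z) (triangle-double k) ⟩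
      224 + 120 * k + 16 * (k * k)             ≡⟨ square k ⟩
      (14 + k * 4) * ((14 + k * 4) + 2)        ∎)
    where
    open ≡-Reasoning
    regroup : ∀ k t → 224 + 136 * k + 32 * t ≡ 224 + 120 * k + 16 * (2 * t + k)
    regroup = solve-∀
    square : ∀ k → 224 + 120 * k + 16 * (k * k) ≡ (14 + k * 4) * ((14 + k * 4) + 2)
    square = solve-∀
  τ-residue 2 k _ = trans (τ-periodic 2 k {8} {30} {8} {0} refl (≤ᵇ⇒≤ 8 13 _)) (count k (triangle k))
    where
    count : ∀ k t → 30 + 8 * k + 0 * t ≡ 2 * (15 + k * 4)
    count = solve-∀
  τ-residue 3 k _ = trans (τ-periodic 3 k {8} {4} {0} {0} refl (≤ᵇ⇒≤ 8 13 _)) (count k (triangle k))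
    where
    count : ∀ k t → 4 + 0 * k + 0 * t ≡ 4
    count = solve-∀
  τ-residue (suc (suc (suc (suc _)))) _ (s≤s (s≤s (s≤s (s≤s ()))))

  τ-large : ∀ r k → r < 4 → τ (P₂□C ((13 + r) + k * 4)) ≡ expected ((13 + r) + k * 4)
  τ-large r k r<4 = trans (τ-residue r k r<4)
    (cong (λ i → byResidue i ((13 + r) + k * 4)) (sym ([m+kn]%n≡m%n (13 + r) k 4)))

  τ-by-size : ∀ {n} → Size n → τ (P₂□C n) ≡ expected n
  τ-by-size (small i i≤9)   = τ-small i i≤9
  τ-by-size (large r k r<4) = τ-large r k r<4

  τ-P₂□C : ∀ n → 3 ≤ n → τ (P₂□C n) ≡ expected n
  τ-P₂□C n 3≤n = τ-by-size (size-of n 3≤n)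

open import Data.Product using (_,_)
open import Relation.Binary.PropositionalEquality using (refl; trans; cong; subst)
open Evaluation using (byResidue; expected-generic; τ-P₂□C)

differs-by-residue : ∀ {n i} → n % 4 ≡ i → ∀ {m} → m % 4 ≢ i → n ≢ m
differs-by-residue {i = i} n≡i m≢i n≡m = m≢i (subst (λ x → x % 4 ≡ i) n≡m n≡i)

corollary4p4 : (n : ℕ) → 3 ≤ n →
    (n % 4 ≡ 0 → τ (P₂□C n) ≡ 4)
    × (n % 4 ≡ 1 → τ (P₂□C n) ≡ 2 * n)
    × (n % 4 ≡ 3 → n ≢ 3 → τ (P₂□C n) ≡ 2 * n)
    × (n % 4 ≡ 2 → n ≢ 6 → τ (P₂□C n) ≡ n * (n + 2))
    × (n ≡ 3 → τ (P₂□C n) ≡ 9)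
    × (n ≡ 6 → τ (P₂□C n) ≡ 51)
corollary4p4 n 3≤n =
    (λ r → by-residue r (differs-by-residue r λ ()) (differs-by-residue r λ ()))
  , (λ r → by-residue r (differs-by-residue r λ ()) (differs-by-residue r λ ()))
  , (λ r n≢3 → by-residue r n≢3 (differs-by-residue r λ ()))
  , (λ r n≢6 → by-residue r (differs-by-residue r λ ()) n≢6)
  , (λ { refl → τ-P₂□C 3 3≤n })
  , (λ { refl → τ-P₂□C 6 3≤n })
  where
  by-residue : ∀ {i} → n % 4 ≡ i → n ≢ 3 → n ≢ 6 → τ (P₂□C n) ≡ byResidue i n
  by-residue r n≢3 n≢6 =
    trans (τ-P₂□C n 3≤n) (trans (expected-generic n n≢3 n≢6) (cong (λ i → byResidue i n) r))
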